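{- Let $T$ be a non-trivial tree rooted in a central vertex $c$ of $T$. If $v\in V(T)$ and $v\neq c$, then $C_1(v)$ is the component of $T-\{v\}$ that contains the parent of $v$.
   Context: The eccentricity of $v$ is $e(v)=\max\{d(v,u)\mid u\in V(T)\}$, the radius is $\operatorname{rad}(T)=\min_v e(v)$, and a central vertex is a vertex with $e(v)=\operatorname{rad}(T)$. In the tree rooted at $c$, the parent of $v\neq c$ is its neighbour $u$ with $d(u,c)<d(v,c)$. For a vertex $v$, the components of $T-\{v\}$ are its maximal connected subgraphs; for such a component $C(v)$, $\operatorname{reach}(C(v))=\max\{d(v,u)\mid u\in V(C(v))\cup\{v\}\}$. The components of $T-\{v\}$ are denoted $C_1(v),\dots,C_{\deg(v)}(v)$ so that $\operatorname{reach}(C_i(v))\ge\operatorname{reach}(C_{i+1}(v))$ for all $i$. -}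

module Defs where

open import Data.Nat using (ℕ; zero; suc; _≤_; _<_)
open import Data.Fin using (Fin)
open import Data.List using (List; []; _∷_)
open import Data.List.Relation.Unary.All using (All)
open import Data.List.Relation.Unary.Any using (Any)
open import Data.List.Relation.Unary.AllPairs using (AllPairs)
open import Data.List.Relation.Unary.Linked using (Linked)
open import Data.List.Relation.Unary.Unique.Propositional using (Unique)
open import Data.Product using (Σ; ∃; ∃-syntax; _×_; _,_)
open import Data.Sum using (_⊎_)
open import Data.Unit using (⊤)
open import Relation.Nullary using (¬_)
open import Relation.Binary.PropositionalEquality using (_≡_; _≢_)

record Graph (n : ℕ) : Set₁ where
  field
    E      : Fin n → Fin n → Set
    sym    : ∀ {u w} → E u w → E w u
    irrefl : ∀ {u} → ¬ E u u

module _ {n : ℕ} (G : Graph n) where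
  open Graph G

  data WalkIn (P : Fin n → Set) : Fin n → Fin n → ℕ → Set where
    here : ∀ {u} → P u → WalkIn P u u 0
    step : ∀ {u w x k} → P u → E u w → WalkIn P w x k → WalkIn P u x (suc k)

  Walk : Fin n → Fin n → ℕ → Set
  Walk = WalkIn (λ _ → ⊤)

  verts : ∀ {P u w k} → WalkIn P u w k → List (Fin n)
  verts (here {u} _)       = u ∷ []
  verts (step {u} _ _ rest) = u ∷ verts rest

  Connected : Set
  Connected = ∀ u w → ∃[ k ] Walk u w k

  Acyclic : Set
  Acyclic = ¬ (Σ (Fin n) λ u → Σ (Fin n) λ w → Σ ℕ λ k →
              2 ≤ k × (Σ (Walk u w k) λ p → Unique (verts p)) × E w u)

  IsTree : Set
  IsTree = Connected × Acyclic

  IsDist : Fin n → Fin n → ℕ → Set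
  IsDist u w d = Walk u w d × (∀ m → Walk u w m → d ≤ m)

  IsEcc : Fin n → ℕ → Set
  IsEcc v e = (∀ u d → IsDist v u d → d ≤ e) × (∃[ u ] IsDist v u e)

  IsCentral : Fin n → Set
  IsCentral c = ∀ w ec ew → IsEcc c ec → IsEcc w ew → ec ≤ ew

  IsParent : Fin n → Fin n → Fin n → Set
  IsParent c v p = E v p × (∀ dp dv → IsDist p c dp → IsDist v c dv → dp < dv)

  InComp : Fin n → Fin n → Fin n → Set
  InComp v a u = ∃[ k ] WalkIn (λ x → x ≢ v) a u k

  IsReach : Fin n → Fin n → ℕ → Set
  IsReach v a r =
    (∀ u d → (u ≡ v ⊎ InComp v a u) → IsDist v u d → d ≤ r) ×
    (∃[ u ] ((u ≡ v ⊎ InComp v a u) × IsDist v u r))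

  -- reps = a₁ ∷ … ∷ a_m is a listing C_1(v), …, C_m(v) of all components of
  -- T - {v} (component C_i(v) being the one containing a_i), each listed once,
  -- with reach(C_i(v)) ≥ reach(C_{i+1}(v)).
  IsComponentListing : Fin n → List (Fin n) → Set
  IsComponentListing v reps =
    All (_≢ v) reps ×
    AllPairs (λ a b → ¬ InComp v a b) reps ×
    (∀ u → u ≢ v → Any (λ a → InComp v a u) reps) ×
    Linked (λ a b → ∀ ra rb → IsReach v a ra → IsReach v b rb → rb ≤ ra) reps

{-# OPTIONS --safe #-}
-- Let C₁(v) be the component listed first and suppose its reach is attained at u.
-- Since c is central and the listing is sorted by reach, d(c,u) ≤ e(c) ≤ e(v) =
-- reach(C₁(v)) = d(v,u).  A shortest c–u path through v would make d(v,u) < d(c,u),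
-- so it avoids v and C₁(v) contains c.  A shortest p–c path avoids v for the same
-- reason (d(p,c) < d(v,c)), so C₁(v) also contains p.  Distances, eccentricities and
-- reaches are minima and maxima of properties that need not be decidable, so they
-- exist only under double negation; this suffices because membership in C₁(v) is
-- ¬¬-stable, every vertex other than v lying in exactly one listed component.
module Submission where

open import Defs
open import Data.Nat using (ℕ; _≤_; _<_)
open import Data.Nat.Properties
  using (≤-refl; ≤-trans; ≤-<-trans; <-asym; <⇒≱; ≮⇒≥; m<n⇒m<1+n)
open import Data.Nat.Induction using (<-rec)
open import Data.Fin using (Fin; _≟_)
open import Data.Fin.Properties using (sequence)
open import Data.List using (List; _∷_; filter; allFin)
open import Data.List.Membership.Propositional.Properties using (∈-filter⁺; ∈-allFin)
open import Data.List.Extrema.Nat using (argmax; argmax-all; f[xs]≤f[argmax])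
open import Data.List.Relation.Unary.All as All using (All; _∷_)
open import Data.List.Relation.Unary.All.Properties using (all-filter)
open import Data.List.Relation.Unary.Any using (Any; here; there)
open import Data.List.Relation.Unary.AllPairs using (_∷_)
open import Data.List.Relation.Unary.Linked using (Linked; _∷_)
open import Data.Product using (Σ; ∃-syntax; _×_; _,_; proj₁; proj₂)
open import Data.Sum as Sum using (_⊎_; inj₁; inj₂; [_,_])
open import Data.Unit using (⊤; tt)
open import Effect.Monad using (RawMonad)
open import Function using (_∘′_)
open import Level using (0ℓ)
open import Relation.Nullary using (¬_; yes; no; contradiction)
open import Relation.Nullary.Decidable using (¬¬-excluded-middle)
open import Relation.Nullary.Negation using (¬¬-Monad)
open import Relation.Unary using (Pred; Decidable)
open import Relation.Binary.PropositionalEquality using (_≡_; _≢_; refl; sym)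

open RawMonad (¬¬-Monad {0ℓ})

Least : Pred ℕ 0ℓ → Set
Least P = ∃[ m ] P m × (∀ j → P j → m ≤ j)

¬¬-least : ∀ {P : Pred ℕ 0ℓ} k → P k → ¬ ¬ Least P
¬¬-least {P} = <-rec (λ k → P k → ¬ ¬ Least P) λ k smaller Pk → do
  yes (j , j<k , Pj) ← ¬¬-excluded-middle {A = ∃[ j ] j < k × P j}
    where no none → pure (k , Pk , λ j Pj → ≮⇒≥ λ j<k → none (j , j<k , Pj))
  smaller j<k Pj

Argmax : ∀ {m} → Pred (Fin m) 0ℓ → (Fin m → ℕ) → Set
Argmax Q f = ∃[ u ] Q u × (∀ w → Q w → f w ≤ f u)

argmax-dec : ∀ {m} {Q : Pred (Fin m) 0ℓ} → Decidable Q → (f : Fin m → ℕ) →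
             ∀ {u₀} → Q u₀ → Argmax Q f
argmax-dec {m} Q? f {u₀} Qu₀ =
  argmax f u₀ candidates ,
  argmax-all f Qu₀ (all-filter Q? (allFin m)) ,
  λ w Qw → All.lookup (f[xs]≤f[argmax] u₀ candidates) (∈-filter⁺ Q? (∈-allFin w) Qw)
  where candidates = filter Q? (allFin m)

¬¬-argmax : ∀ {m} {Q : Pred (Fin m) 0ℓ} (f : Fin m → ℕ) → ∀ {u₀} → Q u₀ → ¬ ¬ Argmax Q f
¬¬-argmax f Qu₀ = do
  Q? ← sequence rawApplicative (λ _ → ¬¬-excluded-middle)
  pure (argmax-dec Q? f Qu₀)

module Paths {n : ℕ} (T : Graph n) where
  open Graph T using (E) renaming (sym to E-sym)

  Dist : Fin n → Fin n → Set
  Dist x y = Σ ℕ (IsDist T x y)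

  _++ʷ_ : ∀ {P x y z k m} → WalkIn T P x y k → WalkIn T P y z m → ∃[ l ] WalkIn T P x z l
  here _       ++ʷ q = _ , q
  step Px e p ++ʷ q with p ++ʷ q
  ... | _ , pq = _ , step Px e pq

  first : ∀ {P x y k} → WalkIn T P x y k → P x
  first (here Px)     = Px
  first (step Px _ _) = Px

  last : ∀ {P x y k} → WalkIn T P x y k → P y
  last (here Py)    = Py
  last (step _ _ p) = last p

  reverseʷ : ∀ {P x y k} → WalkIn T P x y k → ∃[ l ] WalkIn T P y x l
  reverseʷ (here Px) = _ , here Px
  reverseʷ (step Px e p) with reverseʷ p
  ... | _ , p⁻¹ = p⁻¹ ++ʷ step (first p) (E-sym e) (here Px)

  InComp-sym : ∀ {v a b} → InComp T v a b → InComp T v b a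
  InComp-sym (_ , p) = reverseʷ p

  InComp-trans : ∀ {v a b c} → InComp T v a b → InComp T v b c → InComp T v a c
  InComp-trans (_ , p) (_ , q) = p ++ʷ q

  InComp-≢ : ∀ {v a b} → InComp T v a b → b ≢ v
  InComp-≢ (_ , p) = last p

  avoids⊎through : ∀ {v x y k} → x ≢ v → Walk T x y k →
                   WalkIn T (_≢ v) x y k ⊎ ∃[ j ] j < k × Walk T v y j
  avoids⊎through x≢v (here _) = inj₁ (here x≢v)
  avoids⊎through {v} x≢v (step {w = w} _ e p) with w ≟ v
  ... | yes refl = inj₂ (_ , ≤-refl , p)
  ... | no w≢v   = Sum.map (step x≢v e) (λ (j , j<k , q) → j , m<n⇒m<1+n j<k , q)
                           (avoids⊎through w≢v p)

  shortest-avoids⊎closer : ∀ {v x y d} → x ≢ v → IsDist T x y d →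
                           InComp T v x y ⊎ (∀ e → IsDist T v y e → e < d)
  shortest-avoids⊎closer x≢v (p , _) with avoids⊎through x≢v p
  ... | inj₁ avoiding      = inj₁ (_ , avoiding)
  ... | inj₂ (j , j<d , q) = inj₂ λ e (_ , minimal) → ≤-<-trans (minimal j q) j<d

  ¬¬-dist : Connected T → ∀ x y → ¬ ¬ Dist x y
  ¬¬-dist connected x y = let k , p = connected x y in ¬¬-least k p

  ¬¬-dists : Connected T → ∀ x → ¬ ¬ (∀ y → Dist x y)
  ¬¬-dists connected x = sequence rawApplicative (¬¬-dist connected x)

  ¬¬-farthest : ∀ {x} (D : ∀ y → Dist x y) {Q : Pred (Fin n) 0ℓ} {u₀} → Q u₀ →
                ¬ ¬ (∃[ u ] Q u × (∀ w d → Q w → IsDist T x w d → d ≤ proj₁ (D u)))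
  ¬¬-farthest D Qu₀ = do
    u , Qu , max ← ¬¬-argmax (λ y → proj₁ (D y)) Qu₀
    pure (u , Qu , λ w d Qw (_ , minimal) → ≤-trans (minimal _ (proj₁ (proj₂ (D w)))) (max w Qw))

  ¬¬-ecc : ∀ {x} → (∀ y → Dist x y) → ¬ ¬ Σ ℕ (IsEcc T x)
  ¬¬-ecc {x} D = do
    u , _ , max ← ¬¬-farthest D {Q = λ _ → ⊤} {x} tt
    pure (proj₁ (D u) , (λ w d → max w d tt) , u , proj₂ (D u))

  ¬¬-reach : ∀ {v} → (∀ y → Dist v y) → ∀ a → ¬ ¬ Σ ℕ (IsReach T v a)
  ¬¬-reach {v} D a = do
    u , Qu , max ← ¬¬-farthest D {Q = λ u → u ≡ v ⊎ InComp T v a u} (inj₁ refl)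
    pure (proj₁ (D u) , max , u , Qu , proj₂ (D u))

  ReachNonIncreasing : Fin n → Fin n → Fin n → Set
  ReachNonIncreasing v a b = ∀ ra rb → IsReach T v a ra → IsReach T v b rb → rb ≤ ra

  dist≤head-reach : ∀ {v h rest rh u d} → Linked (ReachNonIncreasing v) (h ∷ rest) →
                    All (Σ ℕ ∘′ IsReach T v) rest → IsReach T v h rh →
                    Any (λ a → InComp T v a u) (h ∷ rest) → IsDist T v u d → d ≤ rh
  dist≤head-reach _ _ Rh (here u∈h) Du = proj₁ Rh _ _ (inj₂ u∈h) Du
  dist≤head-reach (h≥a ∷ sorted) ((ra , Ra) ∷ Rs) Rh (there u∈rest) Du =
    ≤-trans (dist≤head-reach sorted Rs Ra u∈rest Du) (h≥a _ _ Rh Ra)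

  ecc≤head-reach : ∀ {v h rest e rh} → IsComponentListing T v (h ∷ rest) →
                   All (Σ ℕ ∘′ IsReach T v) rest → IsEcc T v e → IsReach T v h rh → e ≤ rh
  ecc≤head-reach {v} (_ , _ , covered , sorted) Rs (_ , u , Du) Rh with u ≟ v
  ... | yes u≡v = proj₁ Rh _ _ (inj₁ u≡v) Du
  ... | no u≢v  = dist≤head-reach sorted Rs Rh (covered u u≢v) Du

  ¬¬-reaches : ∀ {v} → (∀ y → Dist v y) → ∀ as → ¬ ¬ All (Σ ℕ ∘′ IsReach T v) as
  ¬¬-reaches D as = All.sequenceA 0ℓ rawApplicative (All.tabulate λ {a} _ → ¬¬-reach D a)

  head-InComp-stable : ∀ {v h rest u} → IsComponentListing T v (h ∷ rest) → u ≢ v →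
                       ¬ ¬ InComp T v h u → InComp T v h u
  head-InComp-stable {u = u} (_ , (h≁rest ∷ _) , covered , _) u≢v ¬¬h~u with covered u u≢v
  ... | here h~u     = h~u
  ... | there rest~u = contradiction (λ h~u →
          All.lookupWith (λ h≁a a~u → h≁a (InComp-trans h~u (InComp-sym a~u))) h≁rest rest~u)
        ¬¬h~u

  neighbour-≢ : ∀ {x y} → E x y → y ≢ x
  neighbour-≢ xy refl = Graph.irrefl T xy

  parent-side-contains-root : ∀ {c v p dp dv} → IsParent T c v p →
                              IsDist T p c dp → IsDist T v c dv → InComp T v p c
  parent-side-contains-root (vp , p-closer) Dp Dv with shortest-avoids⊎closer (neighbour-≢ vp) Dp
  ... | inj₁ p~c      = p~c
  ... | inj₂ v-closer = contradiction (p-closer _ _ Dp Dv) (<-asym (v-closer _ Dv))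

  reach≥ecc⇒InComp : ∀ {v a c ec rh} → c ≢ v → (∀ y → Dist c y) → IsEcc T c ec → ec ≤ rh →
                     IsReach T v a rh → InComp T v a c
  reach≥ecc⇒InComp c≢v Dc (ecc-bound , _) ec≤rh (_ , u , u≡v⊎a~u , Du)
    with shortest-avoids⊎closer c≢v (proj₂ (Dc u))
  ... | inj₂ v-closer =
    contradiction (≤-trans (ecc-bound u _ (proj₂ (Dc u))) ec≤rh) (<⇒≱ (v-closer _ Du))
  ... | inj₁ c~u      =
    [ (λ u≡v → contradiction u≡v (InComp-≢ c~u)) , (λ a~u → InComp-trans a~u (InComp-sym c~u)) ]
      u≡v⊎a~u

lemma3p3 : ∀ {n : ℕ} (T : Graph n) → 2 ≤ n → IsTree T →
    (c : Fin n) → IsCentral T c →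
    (v : Fin n) → v ≢ c → (p : Fin n) → IsParent T c v p →
    (reps : List (Fin n)) → IsComponentListing T v reps →
    ∀ h rest → reps ≡ h ∷ rest → InComp T v h p
lemma3p3 T _ (connected , _) c central v v≢c p parent@(vp , _) _ listing h rest refl =
  head-InComp-stable listing (neighbour-≢ vp) do
    Dv ← ¬¬-dists connected v
    Dc ← ¬¬-dists connected c
    _ , Dpc ← ¬¬-dist connected p c
    e , Ev ← ¬¬-ecc Dv
    ec , Ec ← ¬¬-ecc Dc
    rh , Rh ← ¬¬-reach Dv h
    Rs ← ¬¬-reaches Dv rest
    let ec≤rh = ≤-trans (central v ec e Ec Ev) (ecc≤head-reach listing Rs Ev Rh)
        h~c   = reach≥ecc⇒InComp (v≢c ∘′ sym) Dc Ec ec≤rh Rh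
        p~c   = parent-side-contains-root parent Dpc (proj₂ (Dv c))
    pure (InComp-trans h~c (InComp-sym p~c))
  where open Paths T
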